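{- For every $n_1,n_2\in\mathbb N$, there are an NRC expression $\widehat{\mathrm{Pair}}(x,y)$ from $\mathsf{Ur}_{n_1},\mathsf{Ur}_{n_2}$ to $\mathsf{Ur}_{\max(n_1,n_2)+2}$ and $\mathrm{NRC}[\mathrm{get}]$ expressions $\hat\pi_i(x)$ from $\mathsf{Ur}_{\max(n_1,n_2)+2}$ to $\mathsf{Ur}_{n_i}$ for $i\in\{1,2\}$ such that $\hat\pi_1(\widehat{\mathrm{Pair}}(a_1,a_2))=a_1$ and $\hat\pi_2(\widehat{\mathrm{Pair}}(a_1,a_2))=a_2$ for all $a_1,a_2$. Furthermore, there is a $\Delta_0$ formula $\mathrm{Im}_{\widehat{\mathrm{Pair}}}(x)$ such that $\mathrm{Im}_{\widehat{\mathrm{Pair}}}(a)$ holds if and only if there exist $a_1,a_2$ with $\widehat{\mathrm{Pair}}(a_1,a_2)=a$; and in that case $\widehat{\mathrm{Pair}}(\hat\pi_1(a),\hat\pi_2(a))=a$.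
   Context: Monadic types: $\mathsf{Ur}_0=\mathsf{Ur}$ (a fixed set of atoms) and $\mathsf{Ur}_{n+1}=\mathsf{Set}(\mathsf{Ur}_n)$, interpreted as (possibly infinite) sets. NRC expressions are built from variables, $\langle\rangle$, pairing, projections, $\emptyset$, singletons $\{E\}$, $E_1\cup E_2$, $E_1\setminus E_2$ and $\bigcup\{E_1\mid x\in E_2\}$, with standard semantics; $\mathrm{NRC}[\mathrm{get}]$ adds $\mathrm{get}_T(E)$, returning the unique element of $E$ if $E$ is a singleton and a fixed default element of $T$ otherwise. $\Delta_0$ formulas: typed terms built from variables by $\langle\rangle$, pairing, projections; formulas from $t=_{\mathsf{Ur}}t'$, $t\neq_{\mathsf{Ur}}t'$, $\top,\bot,\wedge,\vee$ and bounded quantifiers $\forall x\in t$, $\exists x\in t$. -}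

module Defs where

open import Level using (Level; Lift; lift; lower) renaming (zero to lzero; suc to lsuc)
open import Data.Nat using (ℕ; zero; suc)
open import Data.Bool using (Bool; true; false)
open import Data.Unit using (⊤; tt)
open import Data.Empty using (⊥; ⊥-elim)
open import Data.Product using (Σ; _×_; _,_; proj₁; proj₂; ∃)
open import Data.Sum using (_⊎_; inj₁; inj₂)
open import Data.List using (List; []; _∷_)
open import Data.List.Membership.Propositional using (_∈_)
open import Data.List.Relation.Unary.Any using (here; there)
open import Relation.Binary.PropositionalEquality using (_≡_; refl)
open import Relation.Nullary using (Dec; yes; no; ¬_)

data Ty : Set where
  Ur   : Ty
  𝟙    : Ty
  _⊗_  : Ty → Ty → Ty
  SetT : Ty → Ty

UrT : ℕ → Ty
UrT zero    = Ur
UrT (suc n) = SetT (UrT n)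

Ctx : Set
Ctx = List Ty

-- NRC expressions (intrinsically typed, de Bruijn variables).
-- The flag g says whether the `get` construct is allowed:
-- Expr false = NRC, Expr true = NRC[get].

data Expr (g : Bool) (Γ : Ctx) : Ty → Set where
  var   : ∀ {T} → T ∈ Γ → Expr g Γ T
  unit  : Expr g Γ 𝟙
  pair  : ∀ {T U} → Expr g Γ T → Expr g Γ U → Expr g Γ (T ⊗ U)
  fst   : ∀ {T U} → Expr g Γ (T ⊗ U) → Expr g Γ T
  snd   : ∀ {T U} → Expr g Γ (T ⊗ U) → Expr g Γ U
  empty : ∀ {T} → Expr g Γ (SetT T)
  sng   : ∀ {T} → Expr g Γ T → Expr g Γ (SetT T)
  union : ∀ {T} → Expr g Γ (SetT T) → Expr g Γ (SetT T) → Expr g Γ (SetT T)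
  diff  : ∀ {T} → Expr g Γ (SetT T) → Expr g Γ (SetT T) → Expr g Γ (SetT T)
  -- bigU E₁ E₂  is  ⋃ { E₁ | x ∈ E₂ },  x bound in E₁ (de Bruijn index 0)
  bigU  : ∀ {T U} → Expr g (T ∷ Γ) (SetT U) → Expr g Γ (SetT T) → Expr g Γ (SetT U)
  get   : ∀ {T} → g ≡ true → Expr g Γ (SetT T) → Expr g Γ T

data Term (Γ : Ctx) : Ty → Set where
  var  : ∀ {T} → T ∈ Γ → Term Γ T
  unit : Term Γ 𝟙
  pair : ∀ {T U} → Term Γ T → Term Γ U → Term Γ (T ⊗ U)
  fst  : ∀ {T U} → Term Γ (T ⊗ U) → Term Γ T
  snd  : ∀ {T U} → Term Γ (T ⊗ U) → Term Γ U

data Δ₀ (Γ : Ctx) : Set where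
  eqUr  : Term Γ Ur → Term Γ Ur → Δ₀ Γ
  neqUr : Term Γ Ur → Term Γ Ur → Δ₀ Γ
  tru   : Δ₀ Γ
  fls   : Δ₀ Γ
  _∧_   : Δ₀ Γ → Δ₀ Γ → Δ₀ Γ
  _∨_   : Δ₀ Γ → Δ₀ Γ → Δ₀ Γ
  all∈  : ∀ {T} → Term Γ (SetT T) → Δ₀ (T ∷ Γ) → Δ₀ Γ
  ex∈   : ∀ {T} → Term Γ (SetT T) → Δ₀ (T ∷ Γ) → Δ₀ Γ

-- A (possibly infinite) set of elements of type T is
-- represented as a family  I → ⟦ T ⟧  indexed by an arbitrary type I;
-- equality of values is hereditary extensional equality _≈_.
-- The semantics of `get` needs to decide whether a set is a singleton;
-- the (classical) meta-theory is supplied as an excluded-middle oracle.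

LEM : Set₁
LEM = (P : Set) → Dec P

record SetOf (A : Set₁) : Set₁ where
  constructor fam
  field
    Idx : Set
    elt : Idx → A
open SetOf public

module Semantics (Atom : Set) (default : Atom) (lem : LEM) where

  ⟦_⟧ : Ty → Set₁
  ⟦ Ur ⟧     = Lift (lsuc lzero) Atom
  ⟦ 𝟙 ⟧      = Lift (lsuc lzero) ⊤
  ⟦ T ⊗ U ⟧  = ⟦ T ⟧ × ⟦ U ⟧
  ⟦ SetT T ⟧ = SetOf ⟦ T ⟧

  Eq : (T : Ty) → ⟦ T ⟧ → ⟦ T ⟧ → Set
  Eq Ur a b = lower a ≡ lower b
  Eq 𝟙 a b = ⊤
  Eq (T ⊗ U) (a , b) (a' , b') = Eq T a a' × Eq U b b'
  Eq (SetT T) A B =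
    ((i : Idx A) → Σ (Idx B) λ j → Eq T (elt A i) (elt B j)) ×
    ((j : Idx B) → Σ (Idx A) λ i → Eq T (elt A i) (elt B j))

  _≈_ : ∀ {T} → ⟦ T ⟧ → ⟦ T ⟧ → Set
  _≈_ {T} = Eq T

  _∈ₛ_ : ∀ {T} → ⟦ T ⟧ → ⟦ SetT T ⟧ → Set
  a ∈ₛ A = Σ (Idx A) λ i → a ≈ elt A i

  dflt : (T : Ty) → ⟦ T ⟧
  dflt Ur       = lift default
  dflt 𝟙        = lift tt
  dflt (T ⊗ U)  = dflt T , dflt U
  dflt (SetT T) = fam ⊥ ⊥-elim

  Env : Ctx → Set₁
  Env []      = Lift (lsuc lzero) ⊤
  Env (T ∷ Γ) = ⟦ T ⟧ × Env Γ

  lookupEnv : ∀ {Γ T} → Env Γ → T ∈ Γ → ⟦ T ⟧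
  lookupEnv (v , ρ) (here refl) = v
  lookupEnv (v , ρ) (there i)   = lookupEnv ρ i

  IsSingleton : ∀ {T} → ⟦ SetT T ⟧ → Set
  IsSingleton {T} A = Σ (Idx A) λ i → (j : Idx A) → elt A j ≈ elt A i

  getSem : ∀ {T} → ⟦ SetT T ⟧ → ⟦ T ⟧
  getSem {T} A with lem (IsSingleton A)
  ... | yes (i , _) = elt A i
  ... | no _        = dflt T

  eval : ∀ {g Γ T} → Expr g Γ T → Env Γ → ⟦ T ⟧
  eval (var i) ρ = lookupEnv ρ i
  eval unit ρ = lift tt
  eval (pair e e') ρ = eval e ρ , eval e' ρ
  eval (fst e) ρ = proj₁ (eval e ρ)
  eval (snd e) ρ = proj₂ (eval e ρ)
  eval empty ρ = fam ⊥ ⊥-elim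
  eval (sng e) ρ = fam ⊤ (λ _ → eval e ρ)
  eval (union e e') ρ with eval e ρ | eval e' ρ
  ... | fam I f | fam J h = fam (I ⊎ J) λ { (inj₁ i) → f i ; (inj₂ j) → h j }
  eval (diff e e') ρ with eval e ρ | eval e' ρ
  ... | A | B = fam (Σ (Idx A) λ i → ¬ (elt A i ∈ₛ B)) (λ p → elt A (proj₁ p))
  eval (bigU e₁ e₂) ρ =
    let A = eval e₂ ρ in
    fam (Σ (Idx A) λ i → Idx (eval e₁ (elt A i , ρ)))
        (λ p → elt (eval e₁ (elt A (proj₁ p) , ρ)) (proj₂ p))
  eval (get _ e) ρ = getSem (eval e ρ)

  evalT : ∀ {Γ T} → Term Γ T → Env Γ → ⟦ T ⟧
  evalT (var i) ρ = lookupEnv ρ i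
  evalT unit ρ = lift tt
  evalT (pair t t') ρ = evalT t ρ , evalT t' ρ
  evalT (fst t) ρ = proj₁ (evalT t ρ)
  evalT (snd t) ρ = proj₂ (evalT t ρ)

  Sat : ∀ {Γ} → Δ₀ Γ → Env Γ → Set
  Sat (eqUr t t') ρ = lower (evalT t ρ) ≡ lower (evalT t' ρ)
  Sat (neqUr t t') ρ = ¬ (lower (evalT t ρ) ≡ lower (evalT t' ρ))
  Sat tru ρ = ⊤
  Sat fls ρ = ⊥
  Sat (φ ∧ ψ) ρ = Sat φ ρ × Sat ψ ρ
  Sat (φ ∨ ψ) ρ = Sat φ ρ ⊎ Sat ψ ρ
  Sat (all∈ t φ) ρ = (i : Idx (evalT t ρ)) → Sat φ (elt (evalT t ρ) i , ρ)
  Sat (ex∈ t φ) ρ = Σ (Idx (evalT t ρ)) λ i → Sat φ (elt (evalT t ρ) i , ρ)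

{-# OPTIONS --safe #-}
-- Both components are lifted to the common level m = n₁ ⊔ n₂ by iterated singletons
-- and paired à la Kuratowski as P = {{x}, {x, y}}.  The first projection is the unique
-- element of ⋂P (intersection is NRC-definable by a double difference), the second the
-- unique element of ⋃P ∖ ⋂P, or of ⋂P when that difference is empty (x = y); `get`
-- then strips the singletons again.  The image is Δ₀ because extensional equality,
-- "being {x}", "being {x, y}" and "being an iterated singleton" only need bounded
-- quantification, by induction on the level.
module Submission where

open import Defs
open import Level using (lift) renaming (zero to lzero; suc to lsuc)
open import Data.Nat using (ℕ; _+_; _⊔_; zero; suc; _≤′_; ≤′-refl; ≤′-step)
open import Data.Nat.Properties using (+-comm; ≤⇒≤′; m≤m⊔n; m≤n⊔m)
open import Data.Bool using (Bool; true; false)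
open import Data.Unit using (⊤; tt)
open import Function using (_∘_; id)
open import Data.Empty using (⊥-elim)
open import Data.Product using (Σ; _×_; _,_; proj₁; proj₂; map₂)
open import Data.Sum using (_⊎_; inj₁; inj₂)
import Data.Sum as Sum
open import Data.List using ([]; _∷_)
open import Data.List.Membership.Propositional using (_∈_)
open import Data.List.Relation.Unary.Any using (here; there)
open import Function.Bundles using (_⇔_; mk⇔; Equivalence)
open import Relation.Binary.Bundles using (Setoid)
open import Relation.Binary.PropositionalEquality using (_≡_; refl; cong; subst)
  renaming (sym to ≡-sym; trans to ≡-trans)
open import Relation.Nullary using (yes; no; ¬_)
import Relation.Binary.Reasoning.Setoid as SetoidReasoning

open Equivalence using (to; from)

v0 : ∀ {A : Ty} {Γ} → A ∈ A ∷ Γ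
v0 = here refl

v1 : ∀ {A B : Ty} {Γ} → A ∈ B ∷ A ∷ Γ
v1 = there v0

v2 : ∀ {A B C : Ty} {Γ} → A ∈ C ∷ B ∷ A ∷ Γ
v2 = there v1

v3 : ∀ {A B C D : Ty} {Γ} → A ∈ D ∷ C ∷ B ∷ A ∷ Γ
v3 = there v2

v4 : ∀ {A B C D E : Ty} {Γ} → A ∈ E ∷ D ∷ C ∷ B ∷ A ∷ Γ
v4 = there v3

module Construction (Atom : Set) (default : Atom) (lem : LEM) where
  open Semantics Atom default lem

  ≈-refl : ∀ T {a : ⟦ T ⟧} → Eq T a a
  ≈-refl Ur = refl
  ≈-refl 𝟙 = tt
  ≈-refl (T ⊗ U) = ≈-refl T , ≈-refl U
  ≈-refl (SetT T) = (λ i → i , ≈-refl T) , (λ i → i , ≈-refl T)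

  ≈-sym : ∀ T {a b : ⟦ T ⟧} → Eq T a b → Eq T b a
  ≈-sym Ur e = ≡-sym e
  ≈-sym 𝟙 _ = tt
  ≈-sym (T ⊗ U) (e , e') = ≈-sym T e , ≈-sym U e'
  ≈-sym (SetT T) (f , g) =
    (λ j → proj₁ (g j) , ≈-sym T (proj₂ (g j))) , (λ i → proj₁ (f i) , ≈-sym T (proj₂ (f i)))

  ≈-trans : ∀ T {a b c : ⟦ T ⟧} → Eq T a b → Eq T b c → Eq T a c
  ≈-trans Ur e e' = ≡-trans e e'
  ≈-trans 𝟙 _ _ = tt
  ≈-trans (T ⊗ U) (e₁ , e₂) (e₁' , e₂') = ≈-trans T e₁ e₁' , ≈-trans U e₂ e₂'
  ≈-trans (SetT T) (f , g) (f' , g') =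
    (λ i → proj₁ (f' (proj₁ (f i))) , ≈-trans T (proj₂ (f i)) (proj₂ (f' (proj₁ (f i))))) ,
    (λ k → proj₁ (g (proj₁ (g' k))) , ≈-trans T (proj₂ (g (proj₁ (g' k)))) (proj₂ (g' k)))

  ≡⇒≈ : ∀ T {a b : ⟦ T ⟧} → a ≡ b → Eq T a b
  ≡⇒≈ T refl = ≈-refl T

  ≈-setoid : Ty → Setoid (lsuc lzero) lzero
  ≈-setoid T = record
    { Carrier = ⟦ T ⟧
    ; _≈_ = Eq T
    ; isEquivalence = record { refl = ≈-refl T ; sym = ≈-sym T ; trans = ≈-trans T }
    }

  module ≈-Reasoning (T : Ty) = SetoidReasoning (≈-setoid T)

  Mem : ∀ T → ⟦ T ⟧ → ⟦ SetT T ⟧ → Set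
  Mem T = _∈ₛ_ {T}

  Mem-respˡ : ∀ T {a b} {A : ⟦ SetT T ⟧} → Eq T a b → Mem T b A → Mem T a A
  Mem-respˡ T e (i , e') = i , ≈-trans T e e'

  Mem-respʳ : ∀ T {a} {A B : ⟦ SetT T ⟧} → Eq (SetT T) A B → Mem T a A → Mem T a B
  Mem-respʳ T (f , _) (i , e) = proj₁ (f i) , ≈-trans T e (proj₂ (f i))

  elt-Mem : ∀ T (A : ⟦ SetT T ⟧) i → Mem T (elt A i) A
  elt-Mem T A i = i , ≈-refl T

  single : ∀ {T} → ⟦ T ⟧ → ⟦ SetT T ⟧
  single a = fam ⊤ (λ _ → a)

  doubletonᴱ : ∀ {g Γ T} → Expr g Γ T → Expr g Γ T → Expr g Γ (SetT T)
  doubletonᴱ e e' = union (sng e) (sng e')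

  -- Defined by evaluation so that eval (doubletonᴱ e e') ρ is definitionally
  -- doubleton (eval e ρ) (eval e' ρ).
  doubleton : ∀ {T} → ⟦ T ⟧ → ⟦ T ⟧ → ⟦ SetT T ⟧
  doubleton {T} a b = eval {false} {T ∷ T ∷ []} (doubletonᴱ (var v0) (var v1)) (a , b , lift tt)

  ≈-single⇔ : ∀ T {a} {S : ⟦ SetT T ⟧} →
    Eq (SetT T) S (single a) ⇔ (((i : Idx S) → Eq T (elt S i) a) × Mem T a S)
  ≈-single⇔ T = mk⇔ (λ (f , g) → (λ i → proj₂ (f i)) , (proj₁ (g tt) , ≈-sym T (proj₂ (g tt))))
                 (λ (all , (i , e)) → (λ j → _ , all j) , (λ _ → i , ≈-sym T e))

  ≈-doubleton⇔ : ∀ T {a b} {S : ⟦ SetT T ⟧} →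
    Eq (SetT T) S (doubleton a b) ⇔ (((i : Idx S) → Eq T (elt S i) a ⊎ Eq T (elt S i) b) × Mem T a S × Mem T b S)
  ≈-doubleton⇔ T {a} {b} {S} = mk⇔ to′ from′
    where
    to′ : Eq (SetT T) S (doubleton a b) → _
    to′ (f , g) = side ∘ f , swap (g (inj₁ tt)) , swap (g (inj₂ tt))
      where
      side : ∀ {i} → Σ (⊤ ⊎ ⊤) (λ j → Eq T (elt S i) (elt (doubleton a b) j)) → _
      side (inj₁ _ , e) = inj₁ e
      side (inj₂ _ , e) = inj₂ e
      swap : ∀ {c} → Σ (Idx S) (λ i → Eq T (elt S i) c) → Mem T c S
      swap (i , e) = i , ≈-sym T e
    from′ : _ → Eq (SetT T) S (doubleton a b)
    from′ (sides , (i , ea) , (j , eb)) =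
      side ∘ sides , λ { (inj₁ _) → i , ≈-sym T ea ; (inj₂ _) → j , ≈-sym T eb }
      where
      side : ∀ {i} → Eq T (elt S i) a ⊎ Eq T (elt S i) b →
        Σ (⊤ ⊎ ⊤) (λ j → Eq T (elt S i) (elt (doubleton a b) j))
      side (inj₁ e) = inj₁ tt , e
      side (inj₂ e) = inj₂ tt , e

  single-cong : ∀ T {a b : ⟦ T ⟧} → Eq T a b → Eq (SetT T) (single a) (single b)
  single-cong T e = (λ _ → tt , e) , (λ _ → tt , e)

  doubleton-cong : ∀ T {a a' b b' : ⟦ T ⟧} → Eq T a a' → Eq T b b' →
    Eq (SetT T) (doubleton a b) (doubleton a' b')
  doubleton-cong T ea eb =
    (λ { (inj₁ _) → inj₁ tt , ea ; (inj₂ _) → inj₂ tt , eb }) ,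
    (λ { (inj₁ _) → inj₁ tt , ea ; (inj₂ _) → inj₂ tt , eb })

  Mem-doubleton⁻ : ∀ T {z a b : ⟦ T ⟧} → Mem T z (doubleton a b) → Eq T z a ⊎ Eq T z b
  Mem-doubleton⁻ T (inj₁ _ , e) = inj₁ e
  Mem-doubleton⁻ T (inj₂ _ , e) = inj₂ e

  getSem-single : ∀ T {c} (A : ⟦ SetT T ⟧) → Eq (SetT T) A (single c) → Eq T (getSem {T} A) c
  getSem-single T A A≈c with lem (IsSingleton {T} A)
  ... | yes (i , _) = proj₁ (to (≈-single⇔ T) A≈c) i
  ... | no ¬singleton = ⊥-elim (¬singleton (i , λ j → ≈-trans T (all j) (≈-sym T (all i))))
    where
    all = proj₁ (to (≈-single⇔ T) A≈c)
    i = proj₁ (proj₂ (to (≈-single⇔ T) A≈c))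

  module _ {g : Bool} {Γ : Ctx} (ρ : Env Γ) where
    ∈-∪⁻ : ∀ {T z} (e e' : Expr g Γ (SetT T)) → Mem T z (eval (union e e') ρ) →
      Mem T z (eval e ρ) ⊎ Mem T z (eval e' ρ)
    ∈-∪⁻ e e' (inj₁ i , p) = inj₁ (i , p)
    ∈-∪⁻ e e' (inj₂ j , p) = inj₂ (j , p)

    ∈-∪⁺ˡ : ∀ {T z} (e e' : Expr g Γ (SetT T)) → Mem T z (eval e ρ) → Mem T z (eval (union e e') ρ)
    ∈-∪⁺ˡ e e' (i , p) = inj₁ i , p

    ∈-∪⁺ʳ : ∀ {T z} (e e' : Expr g Γ (SetT T)) → Mem T z (eval e' ρ) → Mem T z (eval (union e e') ρ)
    ∈-∪⁺ʳ e e' (j , p) = inj₂ j , p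

    ∈-∖⁻ : ∀ {T z} (e e' : Expr g Γ (SetT T)) → Mem T z (eval (diff e e') ρ) →
      Mem T z (eval e ρ) × ¬ Mem T z (eval e' ρ)
    ∈-∖⁻ {T} e e' ((i , i∉) , p) = (i , p) , λ z∈ → i∉ (Mem-respˡ T (≈-sym T p) z∈)

    ∈-∖⁺ : ∀ {T z} (e e' : Expr g Γ (SetT T)) → Mem T z (eval e ρ) → ¬ Mem T z (eval e' ρ) →
      Mem T z (eval (diff e e') ρ)
    ∈-∖⁺ {T} e e' (i , p) z∉ = (i , λ i∈ → z∉ (Mem-respˡ T p i∈)) , p

    ∈-bigU⁻ : ∀ {T U z} (e₁ : Expr g (T ∷ Γ) (SetT U)) (e₂ : Expr g Γ (SetT T)) →
      Mem U z (eval (bigU e₁ e₂) ρ) → Σ (Idx (eval e₂ ρ)) λ i → Mem U z (eval e₁ (elt (eval e₂ ρ) i , ρ))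
    ∈-bigU⁻ e₁ e₂ ((i , k) , p) = i , k , p

    ∈-bigU⁺ : ∀ {T U z} (e₁ : Expr g (T ∷ Γ) (SetT U)) (e₂ : Expr g Γ (SetT T)) (i : Idx (eval e₂ ρ)) →
      Mem U z (eval e₁ (elt (eval e₂ ρ) i , ρ)) → Mem U z (eval (bigU e₁ e₂) ρ)
    ∈-bigU⁺ e₁ e₂ i (k , p) = (i , k) , p

  ⋃ᴱ : ∀ {g Γ T} → SetT (SetT T) ∈ Γ → Expr g Γ (SetT T)
  ⋃ᴱ P = bigU (var v0) (var P)

  -- In context z, the set {z} if z lies outside some member of P and ∅ otherwise.
  missesᴱ : ∀ {g Γ T} → SetT (SetT T) ∈ Γ → Expr g (T ∷ Γ) (SetT T)
  missesᴱ P = bigU (diff (sng (var v1)) (var v0)) (var (there P))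

  ⋂ᴱ : ∀ {g Γ T} → SetT (SetT T) ∈ Γ → Expr g Γ (SetT T)
  ⋂ᴱ P = bigU (diff (sng (var v0)) (missesᴱ P)) (⋃ᴱ P)

  module _ {g : Bool} {Γ : Ctx} {T : Ty} (P : SetT (SetT T) ∈ Γ) (ρ : Env Γ) {z : ⟦ T ⟧} where
    private
      Pᵥ = lookupEnv ρ P
      ⋃ᵥ = eval (⋃ᴱ {g} P) ρ

    ∈-⋃ᴱ⁻ : Mem T z (eval (⋃ᴱ {g} P) ρ) → Σ (Idx Pᵥ) λ k → Mem T z (elt Pᵥ k)
    ∈-⋃ᴱ⁻ = ∈-bigU⁻ {g} ρ (var v0) (var P)

    ∈-⋃ᴱ⁺ : (k : Idx Pᵥ) → Mem T z (elt Pᵥ k) → Mem T z (eval (⋃ᴱ {g} P) ρ)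
    ∈-⋃ᴱ⁺ = ∈-bigU⁺ {g} ρ (var v0) (var P)

    ∈-⋂ᴱ⁻ : Mem T z (eval (⋂ᴱ {g} P) ρ) → (k : Idx Pᵥ) → Mem T z (elt Pᵥ k)
    -- z ∉ missesᴱ P only yields ¬ ¬ (z ∈ Pₖ), hence the appeal to excluded middle.
    ∈-⋂ᴱ⁻ z∈⋂ k with ∈-bigU⁻ {g} ρ (diff (sng (var v0)) (missesᴱ P)) (⋃ᴱ P) z∈⋂
    ... | i , z∈body with ∈-∖⁻ {g} (elt ⋃ᵥ i , ρ) (sng (var v0)) (missesᴱ P) z∈body
                        | lem (Mem T z (elt Pᵥ k))
    ...   | _        , _        | yes z∈Pₖ = z∈Pₖ
    ...   | z∈single , z∉misses | no z∉Pₖ  =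
            ⊥-elim (z∉misses (∈-bigU⁺ {g} (elt ⋃ᵥ i , ρ) (diff (sng (var v1)) (var v0)) (var (there P)) k
              (∈-∖⁺ {g} (elt Pᵥ k , elt ⋃ᵥ i , ρ) (sng (var v1)) (var v0) z∈single z∉Pₖ)))

    ∈-⋂ᴱ⁺ : (k : Idx Pᵥ) → Mem T z (elt Pᵥ k) → ((k : Idx Pᵥ) → Mem T z (elt Pᵥ k)) →
      Mem T z (eval (⋂ᴱ {g} P) ρ)
    ∈-⋂ᴱ⁺ k z∈Pₖ z∈all with ∈-⋃ᴱ⁺ k z∈Pₖ
    ... | i , z≈i = ∈-bigU⁺ {g} ρ (diff (sng (var v0)) (missesᴱ P)) (⋃ᴱ P) i
                      (∈-∖⁺ {g} (elt ⋃ᵥ i , ρ) (sng (var v0)) (missesᴱ P) (tt , z≈i) z∉misses)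
      where
      z∉misses : ¬ Mem T z (eval (missesᴱ {g} P) (elt ⋃ᵥ i , ρ))
      z∉misses z∈ with ∈-bigU⁻ {g} (elt ⋃ᵥ i , ρ) (diff (sng (var v1)) (var v0)) (var (there P)) z∈
      ... | k' , z∈diff =
        proj₂ (∈-∖⁻ {g} (elt Pᵥ k' , elt ⋃ᵥ i , ρ) (sng (var v1)) (var v0) z∈diff) (z∈all k')

  whenEmpty : ∀ {g Γ T U} → Expr g Γ (SetT T) → Expr g (𝟙 ∷ Γ) (SetT U) → Expr g Γ (SetT U)
  whenEmpty A B = bigU B (diff (sng unit) (bigU (sng unit) A))

  module _ {g : Bool} {Γ : Ctx} {T U : Ty} (A : Expr g Γ (SetT T)) (B : Expr g (𝟙 ∷ Γ) (SetT U))
           (ρ : Env Γ) {z : ⟦ U ⟧} where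
    ∈-whenEmpty⁻ : Mem U z (eval (whenEmpty A B) ρ) → ¬ Idx (eval A ρ) × Mem U z (eval B (lift tt , ρ))
    ∈-whenEmpty⁻ (((_ , nonempty∉) , k) , e) = (λ i → nonempty∉ ((i , tt) , tt)) , k , e

    ∈-whenEmpty⁺ : ¬ Idx (eval A ρ) → Mem U z (eval B (lift tt , ρ)) → Mem U z (eval (whenEmpty A B) ρ)
    ∈-whenEmpty⁺ A-empty (k , e) = ((tt , λ (((i , _) , _)) → A-empty i) , k) , e

  kpairᴱ : ∀ {g Γ T} → Expr g Γ T → Expr g Γ T → Expr g Γ (SetT (SetT T))
  kpairᴱ e e' = doubletonᴱ (sng e) (doubletonᴱ e e')

  kpair : ∀ {T} → ⟦ T ⟧ → ⟦ T ⟧ → ⟦ SetT (SetT T) ⟧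
  kpair x y = doubleton (single x) (doubleton x y)

  kpair-cong : ∀ T {x x' y y' : ⟦ T ⟧} → Eq T x x' → Eq T y y' → Eq (SetT (SetT T)) (kpair x y) (kpair x' y')
  kpair-cong T ex ey = doubleton-cong (SetT T) (single-cong T ex) (doubleton-cong T ex ey)

  Mem-kpair-fst : ∀ T {x y : ⟦ T ⟧} {w} → Mem (SetT T) w (kpair x y) → Mem T x w
  Mem-kpair-fst T (inj₁ _ , e) = Mem-respʳ T (≈-sym (SetT T) e) (tt , ≈-refl T)
  Mem-kpair-fst T (inj₂ _ , e) = Mem-respʳ T (≈-sym (SetT T) e) (inj₁ tt , ≈-refl T)

  Mem-kpair⁻ : ∀ T {x y z : ⟦ T ⟧} {w} → Mem (SetT T) w (kpair x y) → Mem T z w → Eq T z x ⊎ Eq T z y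
  Mem-kpair⁻ T (inj₁ _ , e) z∈w = inj₁ (proj₂ (Mem-respʳ T e z∈w))
  Mem-kpair⁻ T (inj₂ _ , e) z∈w = Mem-doubleton⁻ T (Mem-respʳ T e z∈w)

  module _ {g : Bool} {Γ : Ctx} {T : Ty} (P : SetT (SetT T) ∈ Γ) (ρ : Env Γ) {x y : ⟦ T ⟧}
           (P≈ : Eq (SetT (SetT T)) (lookupEnv ρ P) (kpair x y)) where
    private
      Pᵥ = lookupEnv ρ P

      P∋single : Mem (SetT T) (single x) Pᵥ
      P∋single = Mem-respʳ (SetT T) (≈-sym (SetT (SetT T)) P≈) (inj₁ tt , ≈-refl (SetT T))

      P∋doubleton : Mem (SetT T) (doubleton x y) Pᵥ
      P∋doubleton = Mem-respʳ (SetT T) (≈-sym (SetT (SetT T)) P≈) (inj₂ tt , ≈-refl (SetT T))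

      x∈P : (k : Idx Pᵥ) → Mem T x (elt Pᵥ k)
      x∈P k = Mem-kpair-fst T (Mem-respʳ (SetT T) P≈ (elt-Mem (SetT T) Pᵥ k))

    ⋂ᴱ-kpair : Eq (SetT T) (eval (⋂ᴱ {g} P) ρ) (single x)
    ⋂ᴱ-kpair = from (≈-single⇔ T) ((λ i → proj₂ (Mem-respʳ T (≈-sym (SetT T) (proj₂ P∋single)) (z∈P₀ i))) ,
                                ∈-⋂ᴱ⁺ {g} P ρ (proj₁ P∋single) (x∈P _) x∈P)
      where
      z∈P₀ : ∀ i → Mem T (elt (eval (⋂ᴱ {g} P) ρ) i) (elt Pᵥ (proj₁ P∋single))
      z∈P₀ i = ∈-⋂ᴱ⁻ {g} P ρ (elt-Mem T _ i) (proj₁ P∋single)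

    ⋃ᴱ-kpair : Eq (SetT T) (eval (⋃ᴱ {g} P) ρ) (doubleton x y)
    ⋃ᴱ-kpair = from (≈-doubleton⇔ T) (side , ∈-⋃ᴱ⁺ {g} P ρ (proj₁ P∋single) (x∈P _) ,
                                 ∈-⋃ᴱ⁺ {g} P ρ (proj₁ P∋doubleton) (Mem-respʳ T (proj₂ P∋doubleton) (inj₂ tt , ≈-refl T)))
      where
      side : ∀ i → Eq T (elt (eval (⋃ᴱ {g} P) ρ) i) x ⊎ Eq T (elt (eval (⋃ᴱ {g} P) ρ) i) y
      side i with ∈-⋃ᴱ⁻ {g} P ρ (elt-Mem T _ i)
      ... | k , z∈Pₖ = Mem-kpair⁻ T (Mem-respʳ (SetT T) P≈ (elt-Mem (SetT T) Pᵥ k)) z∈Pₖ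

  kfst : ∀ {Γ T} → SetT (SetT T) ∈ Γ → Expr true Γ T
  kfst P = get refl (⋂ᴱ P)

  ⋃∖⋂ᴱ : ∀ {Γ T} → SetT (SetT T) ∈ Γ → Expr true Γ (SetT T)
  ⋃∖⋂ᴱ P = diff (⋃ᴱ P) (⋂ᴱ P)

  ksnd : ∀ {Γ T} → SetT (SetT T) ∈ Γ → Expr true Γ T
  ksnd P = get refl (union (⋃∖⋂ᴱ P) (whenEmpty (⋃∖⋂ᴱ P) (⋂ᴱ (there P))))

  module _ {Γ : Ctx} {T : Ty} (P : SetT (SetT T) ∈ Γ) (ρ : Env Γ) {x y : ⟦ T ⟧}
           (P≈ : Eq (SetT (SetT T)) (lookupEnv ρ P) (kpair x y)) where
    kfst-kpair : Eq T (eval (kfst P) ρ) x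
    kfst-kpair = getSem-single T _ (⋂ᴱ-kpair {true} P ρ P≈)

    private
      ⋂≈ = ⋂ᴱ-kpair {true} P ρ P≈
      ⋃≈ = ⋃ᴱ-kpair {true} P ρ P≈
      D = eval (⋃∖⋂ᴱ P) ρ

      ∈D⇒≈y : ∀ {z} → Mem T z D → Eq T z y
      ∈D⇒≈y z∈D with ∈-∖⁻ ρ (⋃ᴱ {true} P) (⋂ᴱ P) z∈D
      ... | z∈⋃ , z∉⋂ with Mem-doubleton⁻ T (Mem-respʳ T ⋃≈ z∈⋃)
      ...   | inj₁ z≈x = ⊥-elim (z∉⋂ (Mem-respʳ T (≈-sym (SetT T) ⋂≈) (tt , z≈x)))
      ...   | inj₂ z≈y = z≈y

      D-empty⇒y≈x : ¬ Idx D → Eq T y x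
      D-empty⇒y≈x D-empty with lem (Eq T y x)
      ... | yes y≈x = y≈x
      ... | no y≉x =
        ⊥-elim (D-empty (proj₁ (∈-∖⁺ ρ (⋃ᴱ {true} P) (⋂ᴱ P) y∈⋃ λ y∈⋂ → y≉x (proj₂ (Mem-respʳ T ⋂≈ y∈⋂)))))
        where y∈⋃ = Mem-respʳ T (≈-sym (SetT T) ⋃≈) (inj₂ tt , ≈-refl T)

      R = eval (union (⋃∖⋂ᴱ P) (whenEmpty (⋃∖⋂ᴱ P) (⋂ᴱ (there P)))) ρ

      R-elt≈y : (i : Idx R) → Eq T (elt R i) y
      R-elt≈y i with ∈-∪⁻ ρ (⋃∖⋂ᴱ P) (whenEmpty (⋃∖⋂ᴱ P) (⋂ᴱ (there P))) (elt-Mem T R i)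
      ... | inj₁ z∈D = ∈D⇒≈y z∈D
      ... | inj₂ z∈W with ∈-whenEmpty⁻ (⋃∖⋂ᴱ P) (⋂ᴱ (there P)) ρ z∈W
      ...   | D-empty , z∈⋂ =
              ≈-trans T (proj₂ (Mem-respʳ T ⋂≈ z∈⋂)) (≈-sym T (D-empty⇒y≈x D-empty))

      y∈R : Mem T y R
      y∈R with lem (Idx D)
      ... | yes i = ∈-∪⁺ˡ ρ (⋃∖⋂ᴱ P) (whenEmpty (⋃∖⋂ᴱ P) (⋂ᴱ (there P)))
                      (Mem-respˡ T (≈-sym T (∈D⇒≈y (elt-Mem T D i))) (elt-Mem T D i))
      ... | no D-empty = ∈-∪⁺ʳ ρ (⋃∖⋂ᴱ P) (whenEmpty (⋃∖⋂ᴱ P) (⋂ᴱ (there P)))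
                           (∈-whenEmpty⁺ (⋃∖⋂ᴱ P) (⋂ᴱ (there P)) ρ D-empty
                             (Mem-respʳ T (≈-sym (SetT T) ⋂≈) (tt , D-empty⇒y≈x D-empty)))

    ksnd-kpair : Eq T (eval (ksnd P) ρ) y
    ksnd-kpair = getSem-single T R (from (≈-single⇔ T) (R-elt≈y , y∈R))

  embᴱ : ∀ {g Γ n k} → n ≤′ k → Expr g Γ (UrT n) → Expr g Γ (UrT k)
  embᴱ ≤′-refl e = e
  embᴱ (≤′-step p) e = sng (embᴱ p e)

  emb : ∀ {n k} → n ≤′ k → ⟦ UrT n ⟧ → ⟦ UrT k ⟧
  emb ≤′-refl a = a
  emb (≤′-step p) a = single (emb p a)

  unembᴱ : ∀ {Γ n k} → n ≤′ k → Expr true Γ (UrT k) → Expr true Γ (UrT n)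
  unembᴱ ≤′-refl e = e
  unembᴱ (≤′-step p) e = unembᴱ p (get refl e)

  unemb : ∀ {n k} → n ≤′ k → ⟦ UrT k ⟧ → ⟦ UrT n ⟧
  unemb ≤′-refl a = a
  unemb (≤′-step p) a = unemb p (getSem a)

  eval-embᴱ : ∀ {g Γ n k} (p : n ≤′ k) (e : Expr g Γ (UrT n)) ρ → eval (embᴱ p e) ρ ≡ emb p (eval e ρ)
  eval-embᴱ ≤′-refl e ρ = refl
  eval-embᴱ (≤′-step p) e ρ = cong single (eval-embᴱ p e ρ)

  eval-unembᴱ : ∀ {Γ n k} (p : n ≤′ k) (e : Expr true Γ (UrT k)) ρ → eval (unembᴱ p e) ρ ≡ unemb p (eval e ρ)
  eval-unembᴱ ≤′-refl e ρ = refl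
  eval-unembᴱ (≤′-step p) e ρ = eval-unembᴱ p (get refl e) ρ

  emb-cong : ∀ {n k} (p : n ≤′ k) {a b} → Eq (UrT n) a b → Eq (UrT k) (emb p a) (emb p b)
  emb-cong ≤′-refl e = e
  emb-cong (≤′-step {k} p) e = single-cong (UrT k) (emb-cong p e)

  unemb-emb : ∀ {n k} (p : n ≤′ k) {w a} → Eq (UrT k) w (emb p a) → Eq (UrT n) (unemb p w) a
  unemb-emb ≤′-refl e = e
  unemb-emb (≤′-step {k} p) {w} e = unemb-emb p (getSem-single (UrT k) w e)

  ≐ᶠ : ∀ {Γ} k → UrT k ∈ Γ → UrT k ∈ Γ → Δ₀ Γ
  ≐ᶠ zero i j = eqUr (var i) (var j)
  ≐ᶠ (suc k) i j =
    all∈ (var i) (ex∈ (var (there j)) (≐ᶠ k v1 v0)) ∧ all∈ (var j) (ex∈ (var (there i)) (≐ᶠ k v0 v1))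

  Sat-≐ᶠ : ∀ {Γ} k (i j : UrT k ∈ Γ) ρ → Sat (≐ᶠ k i j) ρ ⇔ Eq (UrT k) (lookupEnv ρ i) (lookupEnv ρ j)
  Sat-≐ᶠ zero i j ρ = mk⇔ id id
  Sat-≐ᶠ (suc k) i j ρ = mk⇔
    (λ (f , g) → (λ a → map₂ (to (≐ˡ a _)) (f a)) , (λ b → map₂ (to (≐ʳ _ b)) (g b)))
    (λ (f , g) → (λ a → map₂ (from (≐ˡ a _)) (f a)) , (λ b → map₂ (from (≐ʳ _ b)) (g b)))
    where
    A = lookupEnv ρ i
    B = lookupEnv ρ j
    ≐ˡ ≐ʳ : ∀ a b → _ ⇔ Eq (UrT k) (elt A a) (elt B b)
    ≐ˡ a b = Sat-≐ᶠ k v1 v0 (elt B b , elt A a , ρ)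
    ≐ʳ a b = Sat-≐ᶠ k v0 v1 (elt A a , elt B b , ρ)

  Singleᶠ : ∀ {Γ} k → UrT (suc k) ∈ Γ → UrT k ∈ Γ → Δ₀ Γ
  Singleᶠ k s x = all∈ (var s) (≐ᶠ k v0 (there x)) ∧ ex∈ (var s) (≐ᶠ k (there x) v0)

  Sat-Singleᶠ : ∀ {Γ} k (s : UrT (suc k) ∈ Γ) x ρ →
    Sat (Singleᶠ k s x) ρ ⇔ Eq (UrT (suc k)) (lookupEnv ρ s) (single (lookupEnv ρ x))
  Sat-Singleᶠ k s x ρ = mk⇔
    (λ (f , i , e) → from (≈-single⇔ (UrT k)) ((λ j → to (≐ˡ j) (f j)) , i , to (≐ʳ i) e))
    (λ S≈ → let (f , i , e) = to (≈-single⇔ (UrT k)) S≈ in (λ j → from (≐ˡ j) (f j)) , i , from (≐ʳ i) e)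
    where
    S = lookupEnv ρ s
    X = lookupEnv ρ x
    ≐ˡ = λ j → Sat-≐ᶠ k v0 (there x) (elt S j , ρ)
    ≐ʳ = λ j → Sat-≐ᶠ k (there x) v0 (elt S j , ρ)

  Doubletonᶠ : ∀ {Γ} k → UrT (suc k) ∈ Γ → UrT k ∈ Γ → UrT k ∈ Γ → Δ₀ Γ
  Doubletonᶠ k s x y =
    all∈ (var s) (≐ᶠ k v0 (there x) ∨ ≐ᶠ k v0 (there y)) ∧
    (ex∈ (var s) (≐ᶠ k (there x) v0) ∧ ex∈ (var s) (≐ᶠ k (there y) v0))

  Sat-Doubletonᶠ : ∀ {Γ} k (s : UrT (suc k) ∈ Γ) x y ρ →
    Sat (Doubletonᶠ k s x y) ρ ⇔ Eq (UrT (suc k)) (lookupEnv ρ s) (doubleton (lookupEnv ρ x) (lookupEnv ρ y))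
  Sat-Doubletonᶠ k s x y ρ = mk⇔
    (λ (f , (i , ex) , (j , ey)) → from (≈-doubleton⇔ (UrT k))
       ((λ l → Sum.map (to (≐ˡ x l)) (to (≐ˡ y l)) (f l)) , (i , to (≐ʳ x i) ex) , (j , to (≐ʳ y j) ey)))
    (λ S≈ → let (f , (i , ex) , (j , ey)) = to (≈-doubleton⇔ (UrT k)) S≈ in
       (λ l → Sum.map (from (≐ˡ x l)) (from (≐ˡ y l)) (f l)) , (i , from (≐ʳ x i) ex) , (j , from (≐ʳ y j) ey))
    where
    S = lookupEnv ρ s
    ≐ˡ = λ z l → Sat-≐ᶠ k v0 (there z) (elt S l , ρ)
    ≐ʳ = λ z l → Sat-≐ᶠ k (there z) v0 (elt S l , ρ)

  Embᶠ : ∀ {Γ n k} → n ≤′ k → UrT k ∈ Γ → Δ₀ Γ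
  Embᶠ ≤′-refl i = tru
  Embᶠ (≤′-step {k} p) i = ex∈ (var i) (Singleᶠ k (there i) v0 ∧ Embᶠ p v0)

  Sat-Embᶠ : ∀ {Γ n k} (p : n ≤′ k) (i : UrT k ∈ Γ) ρ →
    Sat (Embᶠ p i) ρ ⇔ Σ ⟦ UrT n ⟧ λ a → Eq (UrT k) (emb p a) (lookupEnv ρ i)
  Sat-Embᶠ ≤′-refl i ρ = mk⇔ (λ _ → lookupEnv ρ i , ≈-refl _) (λ _ → tt)
  Sat-Embᶠ (≤′-step {k} p) i ρ = mk⇔
    (λ (j , X≈ , a-emb) → let (a , a≈) = to (Sat-Embᶠ p v0 (elt X j , ρ)) a-emb in
       a , ≈-sym (UrT (suc k)) (≈-trans (UrT (suc k)) (to (Sat-Singleᶠ k (there i) v0 (elt X j , ρ)) X≈)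
                                                     (single-cong (UrT k) (≈-sym (UrT k) a≈))))
    (λ (a , a≈) → let (j , e) = proj₁ a≈ tt in
       j , from (Sat-Singleᶠ k (there i) v0 (elt X j , ρ))
                (≈-trans (UrT (suc k)) (≈-sym (UrT (suc k)) a≈) (single-cong (UrT k) e)) ,
           from (Sat-Embᶠ p v0 (elt X j , ρ)) (a , e))
    where
    X = lookupEnv ρ i

  PairingSpec : ℕ → ℕ → ℕ → Set₁
  PairingSpec n₁ n₂ M =
    Σ (Expr false (UrT n₁ ∷ UrT n₂ ∷ []) (UrT M)) λ Pair →
    Σ (Expr true (UrT M ∷ []) (UrT n₁)) λ π₁ →
    Σ (Expr true (UrT M ∷ []) (UrT n₂)) λ π₂ →
    Σ (Δ₀ (UrT M ∷ [])) λ Im →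
      ((a₁ : ⟦ UrT n₁ ⟧) (a₂ : ⟦ UrT n₂ ⟧) →
         eval π₁ (eval Pair (a₁ , a₂ , lift tt) , lift tt) ≈ a₁) ×
      ((a₁ : ⟦ UrT n₁ ⟧) (a₂ : ⟦ UrT n₂ ⟧) →
         eval π₂ (eval Pair (a₁ , a₂ , lift tt) , lift tt) ≈ a₂) ×
      ((a : ⟦ UrT M ⟧) →
         (Sat Im (a , lift tt) →
            Σ ⟦ UrT n₁ ⟧ λ a₁ → Σ ⟦ UrT n₂ ⟧ λ a₂ → eval Pair (a₁ , a₂ , lift tt) ≈ a) ×
         ((Σ ⟦ UrT n₁ ⟧ λ a₁ → Σ ⟦ UrT n₂ ⟧ λ a₂ → eval Pair (a₁ , a₂ , lift tt) ≈ a) →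
            Sat Im (a , lift tt))) ×
      ((a : ⟦ UrT M ⟧) → Sat Im (a , lift tt) →
         eval Pair (eval π₁ (a , lift tt) , eval π₂ (a , lift tt) , lift tt) ≈ a)

  module Pairing {n₁ n₂ m : ℕ} (p₁ : n₁ ≤′ m) (p₂ : n₂ ≤′ m) where
    private
      S₀ S₂ : Ty
      S₀ = UrT m
      S₂ = UrT (suc (suc m))

    Pairᴱ : Expr false (UrT n₁ ∷ UrT n₂ ∷ []) S₂
    Pairᴱ = kpairᴱ (embᴱ p₁ (var v0)) (embᴱ p₂ (var v1))

    π₁ᴱ : Expr true (S₂ ∷ []) (UrT n₁)
    π₁ᴱ = unembᴱ p₁ (kfst v0)

    π₂ᴱ : Expr true (S₂ ∷ []) (UrT n₂)
    π₂ᴱ = unembᴱ p₂ (ksnd v0)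

    -- ∃u∈a ∃x∈u (Emb₁ x ∧ ∃v∈a ∃y∈v (Emb₂ y ∧ a = {u, v} ∧ u = {x} ∧ v = {x, y}))
    Imᶠ : Δ₀ (S₂ ∷ [])
    Imᶠ = ex∈ (var v0) (ex∈ (var v0) (Embᶠ p₁ v0 ∧ ex∈ (var v2) (ex∈ (var v0)
            (Embᶠ p₂ v0 ∧ (Doubletonᶠ (suc m) v4 v3 v1 ∧ (Singleᶠ m v3 v2 ∧ Doubletonᶠ m v1 v2 v0))))))

    Pair : ⟦ UrT n₁ ⟧ → ⟦ UrT n₂ ⟧ → ⟦ S₂ ⟧
    Pair a₁ a₂ = eval Pairᴱ (a₁ , a₂ , lift tt)

    π₁ : ⟦ S₂ ⟧ → ⟦ UrT n₁ ⟧
    π₁ a = eval π₁ᴱ (a , lift tt)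

    π₂ : ⟦ S₂ ⟧ → ⟦ UrT n₂ ⟧
    π₂ a = eval π₂ᴱ (a , lift tt)

    Pair≈kpair : ∀ a₁ a₂ → Eq S₂ (Pair a₁ a₂) (kpair (emb p₁ a₁) (emb p₂ a₂))
    Pair≈kpair a₁ a₂ = kpair-cong S₀ (≡⇒≈ S₀ (eval-embᴱ p₁ (var v0) _)) (≡⇒≈ S₀ (eval-embᴱ p₂ (var v1) _))

    module _ {a a₁ a₂} (a≈ : Eq S₂ a (kpair (emb p₁ a₁) (emb p₂ a₂))) where
      π₁-kpair : Eq (UrT n₁) (π₁ a) a₁
      π₁-kpair = ≈-trans (UrT n₁) (≡⇒≈ (UrT n₁) (eval-unembᴱ p₁ (kfst v0) (a , lift tt)))
                                  (unemb-emb p₁ (kfst-kpair v0 (a , lift tt) a≈))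

      π₂-kpair : Eq (UrT n₂) (π₂ a) a₂
      π₂-kpair = ≈-trans (UrT n₂) (≡⇒≈ (UrT n₂) (eval-unembᴱ p₂ (ksnd v0) (a , lift tt)))
                                  (unemb-emb p₂ (ksnd-kpair v0 (a , lift tt) a≈))

    Imᶠ-sound : ∀ a → Sat Imᶠ (a , lift tt) →
      Σ ⟦ UrT n₁ ⟧ λ a₁ → Σ ⟦ UrT n₂ ⟧ λ a₂ → Eq S₂ (kpair (emb p₁ a₁) (emb p₂ a₂)) a
    Imᶠ-sound a (iu , ix , x-emb , iv , iy , y-emb , a≈ , u≈ , v≈) =
      a₁ , a₂ , (begin
        kpair (emb p₁ a₁) (emb p₂ a₂)    ≈⟨ kpair-cong S₀ x≈ y≈ ⟩
        kpair x y                        ≈⟨ doubleton-cong (SetT S₀) (to (Sat-Singleᶠ m v3 v2 ρ) u≈)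
                                                              (to (Sat-Doubletonᶠ m v1 v2 v0 ρ) v≈) ⟨
        doubleton u v                    ≈⟨ to (Sat-Doubletonᶠ (suc m) v4 v3 v1 ρ) a≈ ⟨
        a                                ∎)
      where
      open ≈-Reasoning S₂
      u = elt a iu
      x = elt u ix
      v = elt a iv
      y = elt v iy
      ρ = (y , v , x , u , a , lift tt)
      a₁ = proj₁ (to (Sat-Embᶠ p₁ v0 (x , u , a , lift tt)) x-emb)
      x≈ = proj₂ (to (Sat-Embᶠ p₁ v0 (x , u , a , lift tt)) x-emb)
      a₂ = proj₁ (to (Sat-Embᶠ p₂ v0 ρ) y-emb)
      y≈ = proj₂ (to (Sat-Embᶠ p₂ v0 ρ) y-emb)

    Imᶠ-complete : ∀ {a a₁ a₂} → Eq S₂ (kpair (emb p₁ a₁) (emb p₂ a₂)) a → Sat Imᶠ (a , lift tt)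
    Imᶠ-complete {a} {a₁} {a₂} kpair≈a =
      iu , ix , from (Sat-Embᶠ p₁ v0 (x , u , a , lift tt)) (a₁ , x≈) ,
      iv , iy , from (Sat-Embᶠ p₂ v0 ρ) (a₂ , y≈) ,
      from (Sat-Doubletonᶠ (suc m) v4 v3 v1 ρ)
        (≈-trans S₂ (≈-sym S₂ kpair≈a) (doubleton-cong (SetT S₀) u≈ v≈)) ,
      from (Sat-Singleᶠ m v3 v2 ρ) (≈-trans (SetT S₀) (≈-sym (SetT S₀) u≈) (single-cong S₀ x≈)) ,
      from (Sat-Doubletonᶠ m v1 v2 v0 ρ) (≈-trans (SetT S₀) (≈-sym (SetT S₀) v≈) (doubleton-cong S₀ x≈ y≈))
      where
      X = emb p₁ a₁
      Y = emb p₂ a₂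
      a-members = proj₂ (to (≈-doubleton⇔ (SetT S₀)) (≈-sym S₂ kpair≈a))
      iu = proj₁ (proj₁ a-members)
      u≈ = proj₂ (proj₁ a-members)
      iv = proj₁ (proj₂ a-members)
      v≈ = proj₂ (proj₂ a-members)
      u = elt a iu
      v = elt a iv
      ix = proj₁ (proj₁ u≈ tt)
      x≈ = proj₂ (proj₁ u≈ tt)
      iy = proj₁ (proj₁ v≈ (inj₂ tt))
      y≈ = proj₂ (proj₁ v≈ (inj₂ tt))
      x = elt u ix
      y = elt v iy
      ρ = (y , v , x , u , a , lift tt)

    Pair∘π : ∀ a → Sat Imᶠ (a , lift tt) → Eq S₂ (Pair (π₁ a) (π₂ a)) a
    Pair∘π a a∈Im = begin
      Pair (π₁ a) (π₂ a)                  ≈⟨ Pair≈kpair (π₁ a) (π₂ a) ⟩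
      kpair (emb p₁ (π₁ a)) (emb p₂ (π₂ a))
        ≈⟨ kpair-cong S₀ (emb-cong p₁ (π₁-kpair a≈)) (emb-cong p₂ (π₂-kpair a≈)) ⟩
      kpair (emb p₁ a₁) (emb p₂ a₂)        ≈⟨ kpair≈a ⟩
      a                                   ∎
      where
      open ≈-Reasoning S₂
      a₁ = proj₁ (Imᶠ-sound a a∈Im)
      a₂ = proj₁ (proj₂ (Imᶠ-sound a a∈Im))
      kpair≈a = proj₂ (proj₂ (Imᶠ-sound a a∈Im))
      a≈ = ≈-sym S₂ kpair≈a

    pairing : PairingSpec n₁ n₂ (suc (suc m))
    pairing =
      Pairᴱ , π₁ᴱ , π₂ᴱ , Imᶠ ,
      (λ a₁ a₂ → π₁-kpair (Pair≈kpair a₁ a₂)) ,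
      (λ a₁ a₂ → π₂-kpair (Pair≈kpair a₁ a₂)) ,
      (λ a → (λ a∈Im → let (a₁ , a₂ , kpair≈a) = Imᶠ-sound a a∈Im in
                        a₁ , a₂ , ≈-trans S₂ (Pair≈kpair a₁ a₂) kpair≈a) ,
             (λ (a₁ , a₂ , Pair≈a) → Imᶠ-complete (≈-trans S₂ (≈-sym S₂ (Pair≈kpair a₁ a₂)) Pair≈a))) ,
      Pair∘π

proposition4p2 : (Atom : Set) (default : Atom) (lem : LEM) (n₁ n₂ : ℕ) →
    let open Semantics Atom default lem in
    Σ (Expr false (UrT n₁ ∷ UrT n₂ ∷ []) (UrT ((n₁ ⊔ n₂) + 2))) λ Pair →
    Σ (Expr true (UrT ((n₁ ⊔ n₂) + 2) ∷ []) (UrT n₁)) λ π₁ →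
    Σ (Expr true (UrT ((n₁ ⊔ n₂) + 2) ∷ []) (UrT n₂)) λ π₂ →
    Σ (Δ₀ (UrT ((n₁ ⊔ n₂) + 2) ∷ [])) λ Im →
      ((a₁ : ⟦ UrT n₁ ⟧) (a₂ : ⟦ UrT n₂ ⟧) →
         eval π₁ (eval Pair (a₁ , a₂ , lift tt) , lift tt) ≈ a₁) ×
      ((a₁ : ⟦ UrT n₁ ⟧) (a₂ : ⟦ UrT n₂ ⟧) →
         eval π₂ (eval Pair (a₁ , a₂ , lift tt) , lift tt) ≈ a₂) ×
      ((a : ⟦ UrT ((n₁ ⊔ n₂) + 2) ⟧) →
         (Sat Im (a , lift tt) →
            Σ ⟦ UrT n₁ ⟧ λ a₁ → Σ ⟦ UrT n₂ ⟧ λ a₂ → eval Pair (a₁ , a₂ , lift tt) ≈ a) ×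
         ((Σ ⟦ UrT n₁ ⟧ λ a₁ → Σ ⟦ UrT n₂ ⟧ λ a₂ → eval Pair (a₁ , a₂ , lift tt) ≈ a) →
            Sat Im (a , lift tt))) ×
      ((a : ⟦ UrT ((n₁ ⊔ n₂) + 2) ⟧) → Sat Im (a , lift tt) →
         eval Pair (eval π₁ (a , lift tt) , eval π₂ (a , lift tt) , lift tt) ≈ a)
proposition4p2 Atom default lem n₁ n₂ =
  subst (PairingSpec n₁ n₂) (+-comm 2 (n₁ ⊔ n₂))
        (Pairing.pairing (≤⇒≤′ (m≤m⊔n n₁ n₂)) (≤⇒≤′ (m≤n⊔m n₁ n₂)))
  where open Construction Atom default lem
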